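{- For every non-negative integer $m$, $$\tilde H_q(m)=\tilde H_{q^2}\left(\tfrac{m-1}2\right)\tilde H_{q^2}\left(\tfrac m2\right)^2\tilde H_{q^2}\left(\tfrac{m+1}2\right),$$ and the same identity holds with $\tilde H$ replaced by $H$, i.e. $H_q(m)=H_{q^2}\left(\tfrac{m-1}2\right)H_{q^2}\left(\tfrac m2\right)^2H_{q^2}\left(\tfrac{m+1}2\right)$.
   Context: $(x;q)_n=\prod_{i=0}^{n-1}(1-xq^i)$. For $m\in\{0,1,2,\dots\}$: $H_q(m)=\prod_{j=1}^m(q^{ -j/2}-q^{j/2})^{m-j}$ and $\tilde H_q(m)=\prod_{j=1}^m(q;q)_{j-1}$; for $m\in\{ -\frac12,\frac12,\frac32,\dots\}$: $H_q(m)=\prod_{j=1}^{m+1/2}(q^{\frac14-\frac j2}-q^{\frac j2-\frac14})^{m+\frac12-j}$ and $\tilde H_q(m)=\prod_{j=1}^{m+1/2}(q^{1/2};q)_{j-1}$. -}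

module Defs where

open import Level using (Level)
open import Data.Nat using (ℕ; zero; suc; _∸_) renaming (_*_ to _*ℕ_)
open import Data.Integer using (ℤ; +_; -[1+_]) renaming (-_ to negℤ)
open import Algebra.Bundles using (CommutativeRing)

-- Index set {-1/2, 0, 1/2, 1, 3/2, ...} = {0,1,2,...} ∪ {-1/2,1/2,3/2,...}.
--   int n   denotes the integer n
--   half k  denotes the half-integer k - 1/2   (so k = m + 1/2)
data Idx : Set where
  int  : ℕ → Idx
  half : ℕ → Idx

-- halfOf n denotes the number (n - 1)/2.
--   halfOf (2k)   = k - 1/2 = half k
--   halfOf (2k+1) = k       = int k
halfOf : ℕ → Idx
halfOf zero = half 0
halfOf (suc zero) = int 0
halfOf (suc (suc n)) with halfOf n
... | int k  = int (suc k)
... | half k = half (suc k)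

module _ {c ℓ : Level} (R : CommutativeRing c ℓ) where
  open CommutativeRing R

  pow : Carrier → ℕ → Carrier
  pow x zero = 1#
  pow x (suc n) = pow x n * x

  prod1 : ℕ → (ℕ → Carrier) → Carrier
  prod1 zero f = 1#
  prod1 (suc n) f = prod1 n f * f (suc n)

  prod0 : ℕ → (ℕ → Carrier) → Carrier
  prod0 zero f = 1#
  prod0 (suc n) f = prod0 n f * f n

  qPoch : Carrier → Carrier → ℕ → Carrier
  qPoch x q n = prod0 n (λ i → 1# - x * pow q i)

  zpow : Carrier → Carrier → ℤ → Carrier
  zpow r rinv (+ n) = pow r n
  zpow r rinv -[1+ n ] = pow rinv (suc n)

  -- Throughout, r plays the role of q^{1/4} (and rinv of q^{-1/4}),
  -- so q^{a/4} = zpow r rinv a.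

  -- H_q(m):
  --   m integer:      ∏_{j=1}^{m} (q^{-j/2} - q^{j/2})^{m-j}
  --   m = k - 1/2:    ∏_{j=1}^{k} (q^{1/4 - j/2} - q^{j/2 - 1/4})^{k-j}
  H : Carrier → Carrier → Idx → Carrier
  H r rinv (int m) =
    prod1 m (λ j → pow (zpow r rinv (negℤ (+ (2 *ℕ j))) - zpow r rinv (+ (2 *ℕ j))) (m ∸ j))
  H r rinv (half k) =
    prod1 k (λ j → pow (zpow r rinv (negℤ (+ (2 *ℕ j ∸ 1))) - zpow r rinv (+ (2 *ℕ j ∸ 1))) (k ∸ j))

  -- H̃_q(m):
  --   m integer:      ∏_{j=1}^{m} (q;q)_{j-1}
  --   m = k - 1/2:    ∏_{j=1}^{k} (q^{1/2};q)_{j-1}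
  Ht : Carrier → Carrier → Idx → Carrier
  Ht r rinv (int m)  = prod1 m (λ j → qPoch (pow r 4) (pow r 4) (j ∸ 1))
  Ht r rinv (half k) = prod1 k (λ j → qPoch (pow r 2) (pow r 4) (j ∸ 1))

-- Both H̃_q and H_q satisfy G(m+1) = G(m)·g_q(m) along the integers and along the
-- half-integers, where g_q(k) = (q;q)_k and g_q(k−½) = (q^{½};q)_k for H̃, while for H
-- g_q(k) and g_q(k−½) are the products of q^{−j/2} − q^{j/2}, resp. q^{¼−j/2} − q^{j/2−¼},
-- over 1 ≤ j ≤ k. Each g_q is again such an iterated product, and passing from q to q²
-- sorts the factors of g_q(n) into odd- and even-indexed ones:
-- g_q(n) = g_{q²}((n−1)/2)·g_{q²}(n/2). Multiplying these splittings over the steps up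
-- to m, every g_{q²} occurs in two consecutive ones, and the products telescope to
-- G_q(m) = G_{q²}((m−1)/2)·G_{q²}(m/2)²·G_{q²}((m+1)/2).
module Submission where

open import Defs
open import Level using (Level)
open import Data.Nat using (ℕ; zero; suc; _∸_; _≤_) renaming (_*_ to _*ℕ_)
open import Data.Nat.Properties using (*-suc; +-∸-assoc; n∸n≡0; m≤n⇒m≤1+n; ≤-refl)
open import Data.Integer using (+_) renaming (-_ to negℤ)
open import Data.Product using (_×_; _,_)
open import Algebra.Bundles using (CommutativeRing)
open import Relation.Binary.PropositionalEquality as ≡ using (_≡_; cong)

sucIdx : Idx → Idx
sucIdx (int k)  = int (suc k)
sucIdx (half k) = half (suc k)

halfOf-suc-suc : ∀ n → halfOf (suc (suc n)) ≡ sucIdx (halfOf n)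
halfOf-suc-suc n with halfOf n
... | int k  = ≡.refl
... | half k = ≡.refl

halfOf⁻¹ : Idx → ℕ
halfOf⁻¹ (int k)  = suc (2 *ℕ k)
halfOf⁻¹ (half k) = 2 *ℕ k

halfOf⁻¹-halfOf : ∀ n → halfOf⁻¹ (halfOf n) ≡ n
halfOf⁻¹-halfOf zero = ≡.refl
halfOf⁻¹-halfOf (suc zero) = ≡.refl
halfOf⁻¹-halfOf (suc (suc n)) with halfOf n | halfOf⁻¹-halfOf n
... | int k  | ≡.refl = cong suc (*-suc 2 k)
... | half k | ≡.refl = *-suc 2 k

module _ {c ℓ : Level} (R : CommutativeRing c ℓ) where
  open CommutativeRing R hiding (zero)
  open import Relation.Binary.Reasoning.Setoid setoid
  open import Algebra.Solver.CommutativeMonoid *-commutativeMonoid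
    using (solve; _⊜_; _⊕_; id)

  record IsPartialProduct (G g : Idx → Carrier) : Set ℓ where
    field
      start-half : G (half 0) ≈ 1#
      start-int  : G (int 0) ≈ 1#
      step       : ∀ i → G (sucIdx i) ≈ G i * g i

  open IsPartialProduct

  step-halfOf : ∀ {G g} → IsPartialProduct G g →
                ∀ n → G (halfOf (suc (suc n))) ≈ G (halfOf n) * g (halfOf n)
  step-halfOf {G} G↑ n = trans (reflexive (cong G (halfOf-suc-suc n))) (step G↑ (halfOf n))

  module _ {F f G g : Idx → Carrier}
           (F↑ : IsPartialProduct F f) (G↑ : IsPartialProduct G g) where

    interleave : (∀ i → g i ≈ f (int (halfOf⁻¹ i))) →
                 ∀ n → F (int n) ≈ G (halfOf n) * G (halfOf (suc n))
    interleave g≈f zero = begin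
      F (int 0)               ≈⟨ start-int F↑ ⟩
      1#                      ≈⟨ *-identityʳ 1# ⟨
      1# * 1#                 ≈⟨ *-cong (start-half G↑) (start-int G↑) ⟨
      G (half 0) * G (int 0)  ∎
    interleave g≈f (suc n) = begin
      F (int (suc n))          ≈⟨ step F↑ (int n) ⟩
      F (int n) * f (int n)    ≈⟨ *-cong (interleave g≈f n) f≈g ⟩
      (G i * G j) * g i        ≈⟨ solve 3 (λ x y z → (x ⊕ y) ⊕ z ⊜ y ⊕ (x ⊕ z)) refl (G i) (G j) (g i) ⟩
      G j * (G i * g i)        ≈⟨ *-congˡ (step-halfOf G↑ n) ⟨
      G j * G (halfOf (suc (suc n))) ∎
      where
      i j : Idx
      i = halfOf n
      j = halfOf (suc n)
      f≈g : f (int n) ≈ g i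
      f≈g = trans (reflexive (cong (λ k → f (int k)) (≡.sym (halfOf⁻¹-halfOf n)))) (sym (g≈f i))

    interleave² : g (half 0) ≈ 1# → (∀ n → f (int n) ≈ g (halfOf n) * g (halfOf (suc n))) →
                  ∀ n → F (int n) ≈ ((G (halfOf n) * G (halfOf (suc n))) * G (halfOf (suc n)))
                                      * G (halfOf (suc (suc n)))
    interleave² g₀ f≈gg zero = begin
      F (int 0)                                       ≈⟨ start-int F↑ ⟩
      1#                                              ≈⟨ solve 0 (((id ⊕ id) ⊕ id) ⊕ (id ⊕ id) ⊜ id) refl ⟨
      ((1# * 1#) * 1#) * (1# * 1#)                    ≈⟨ *-cong (*-cong (*-cong G₋½ G₀) G₀) (*-cong G₋½ g₀) ⟨
      ((G (half 0) * G (int 0)) * G (int 0)) * (G (half 0) * g (half 0))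
                                                      ≈⟨ *-congˡ (step G↑ (half 0)) ⟨
      ((G (half 0) * G (int 0)) * G (int 0)) * G (half 1) ∎
      where
      G₋½ : G (half 0) ≈ 1#
      G₋½ = start-half G↑
      G₀ : G (int 0) ≈ 1#
      G₀ = start-int G↑
    interleave² g₀ f≈gg (suc n) = begin
      F (int (suc n))                         ≈⟨ step F↑ (int n) ⟩
      F (int n) * f (int n)                   ≈⟨ *-cong (interleave² g₀ f≈gg n) (f≈gg n) ⟩
      (((G i * G j) * G j) * G k) * (g i * g j)
        ≈⟨ solve 5 (λ Ga Gb Gc ga gb → (((Ga ⊕ Gb) ⊕ Gb) ⊕ Gc) ⊕ (ga ⊕ gb) ⊜ ((Gb ⊕ Gc) ⊕ (Ga ⊕ ga)) ⊕ (Gb ⊕ gb))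
                 refl (G i) (G j) (G k) (g i) (g j) ⟩
      ((G j * G k) * (G i * g i)) * (G j * g j)
        ≈⟨ *-cong (*-congˡ (step-halfOf G↑ n)) (step-halfOf G↑ (suc n)) ⟨
      ((G j * G k) * G k) * G (halfOf (suc (suc (suc n)))) ∎
      where
      i j k : Idx
      i = halfOf n
      j = halfOf (suc n)
      k = halfOf (suc (suc n))

  pow-cong : ∀ {x y} n → x ≈ y → pow R x n ≈ pow R y n
  pow-cong zero    x≈y = refl
  pow-cong (suc n) x≈y = *-cong (pow-cong n x≈y) x≈y

  pow-distribʳ-* : ∀ x y n → pow R (x * y) n ≈ pow R x n * pow R y n
  pow-distribʳ-* x y zero    = sym (*-identityʳ 1#)
  pow-distribʳ-* x y (suc n) = begin
    pow R (x * y) n * (x * y)              ≈⟨ *-congʳ (pow-distribʳ-* x y n) ⟩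
    (pow R x n * pow R y n) * (x * y)
      ≈⟨ solve 4 (λ a b c d → (a ⊕ b) ⊕ (c ⊕ d) ⊜ (a ⊕ c) ⊕ (b ⊕ d)) refl (pow R x n) (pow R y n) x y ⟩
    (pow R x n * x) * (pow R y n * y)      ∎

  pow-sq : ∀ x n → pow R (x * x) n ≈ pow R x (2 *ℕ n)
  pow-sq x zero    = refl
  pow-sq x (suc n) = begin
    pow R (x * x) n * (x * x)    ≈⟨ *-congʳ (pow-sq x n) ⟩
    pow R x (2 *ℕ n) * (x * x)   ≈⟨ *-assoc _ x x ⟨
    pow R x (suc (suc (2 *ℕ n))) ≡⟨ cong (pow R x) (*-suc 2 n) ⟨
    pow R x (2 *ℕ suc n)         ∎

  prod1-cong-≤ : ∀ m {f g : ℕ → Carrier} → (∀ j → j ≤ m → f j ≈ g j) → prod1 R m f ≈ prod1 R m g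
  prod1-cong-≤ zero    f≈g = refl
  prod1-cong-≤ (suc m) f≈g =
    *-cong (prod1-cong-≤ m (λ j j≤m → f≈g j (m≤n⇒m≤1+n j≤m))) (f≈g (suc m) ≤-refl)

  prod1-distrib-* : ∀ m (f g : ℕ → Carrier) → prod1 R m (λ j → f j * g j) ≈ prod1 R m f * prod1 R m g
  prod1-distrib-* zero    f g = sym (*-identityʳ 1#)
  prod1-distrib-* (suc m) f g = begin
    prod1 R m (λ j → f j * g j) * (f (suc m) * g (suc m))
      ≈⟨ *-congʳ (prod1-distrib-* m f g) ⟩
    (prod1 R m f * prod1 R m g) * (f (suc m) * g (suc m))
      ≈⟨ solve 4 (λ a b c d → (a ⊕ b) ⊕ (c ⊕ d) ⊜ (a ⊕ c) ⊕ (b ⊕ d)) refl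
               (prod1 R m f) (prod1 R m g) (f (suc m)) (g (suc m)) ⟩
    (prod1 R m f * f (suc m)) * (prod1 R m g * g (suc m)) ∎

  prodPow : (ℕ → Carrier) → ℕ → Carrier
  prodPow F m = prod1 R m (λ j → pow R (F j) (m ∸ j))

  prodPow-suc : ∀ F m → prodPow F (suc m) ≈ prodPow F m * prod1 R m F
  prodPow-suc F m = begin
    prod1 R m (λ j → pow R (F j) (suc m ∸ j)) * pow R (F (suc m)) (suc m ∸ suc m)
      ≈⟨ *-cong (prod1-cong-≤ m (λ j j≤m → reflexive (cong (pow R (F j)) (+-∸-assoc 1 j≤m))))
                (reflexive (cong (pow R (F (suc m))) (n∸n≡0 m))) ⟩
    prod1 R m (λ j → pow R (F j) (m ∸ j) * F j) * 1#  ≈⟨ *-identityʳ _ ⟩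
    prod1 R m (λ j → pow R (F j) (m ∸ j) * F j)       ≈⟨ prod1-distrib-* m _ F ⟩
    prodPow F m * prod1 R m F                         ∎

  HtStep : Carrier → Idx → Carrier
  HtStep r (int k)  = qPoch R (pow R r 4) (pow R r 4) k
  HtStep r (half k) = qPoch R (pow R r 2) (pow R r 4) k

  HtStepFactor : Carrier → Idx → Carrier
  HtStepFactor r (int k)  = 1# - pow R r 4 * pow R (pow R r 4) k
  HtStepFactor r (half k) = 1# - pow R r 2 * pow R (pow R r 4) k

  HtStep-isPartialProduct : ∀ r → IsPartialProduct (HtStep r) (HtStepFactor r)
  HtStep-isPartialProduct r = record
    { start-half = refl
    ; start-int  = refl
    ; step       = λ { (int k) → refl ; (half k) → refl }
    }

  Ht-isPartialProduct : ∀ r rinv → IsPartialProduct (Ht R r rinv) (HtStep r)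
  Ht-isPartialProduct r rinv = record
    { start-half = refl
    ; start-int  = refl
    ; step       = λ { (int k) → refl ; (half k) → refl }
    }

  pow⁴-sq : ∀ r k → pow R (pow R (r * r) 4) k ≈ pow R (pow R r 4) (2 *ℕ k)
  pow⁴-sq r k = trans (pow-cong k (pow-distribʳ-* r r 4)) (pow-sq (pow R r 4) k)

  HtStepFactor-sq : ∀ r i → HtStepFactor (r * r) i ≈ HtStepFactor r (int (halfOf⁻¹ i))
  HtStepFactor-sq r (int k)  = +-congˡ (-‿cong (begin
    pow R (r * r) 4 * pow R (pow R (r * r) 4) k ≈⟨ *-cong (pow-distribʳ-* r r 4) (pow⁴-sq r k) ⟩
    (q * q) * pow R q (2 *ℕ k)
      ≈⟨ solve 2 (λ a b → (a ⊕ a) ⊕ b ⊜ a ⊕ (b ⊕ a)) refl q (pow R q (2 *ℕ k)) ⟩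
    q * (pow R q (2 *ℕ k) * q)                  ∎))
    where
    q : Carrier
    q = pow R r 4
  HtStepFactor-sq r (half k) = +-congˡ (-‿cong (*-cong (pow-sq r 2) (pow⁴-sq r k)))

  powDiff : Carrier → Carrier → ℕ → Carrier
  powDiff r rinv n = zpow R r rinv (negℤ (+ n)) - zpow R r rinv (+ n)

  powDiff-sq : ∀ r rinv n → powDiff (r * r) (rinv * rinv) n ≈ powDiff r rinv (2 *ℕ n)
  powDiff-sq r rinv zero    = refl
  powDiff-sq r rinv (suc n) = +-cong (pow-sq rinv (suc n)) (-‿cong (pow-sq r (suc n)))

  HStep : Carrier → Carrier → Idx → Carrier
  HStep r rinv (int k)  = prod1 R k (λ j → powDiff r rinv (2 *ℕ j))
  HStep r rinv (half k) = prod1 R k (λ j → powDiff r rinv (2 *ℕ j ∸ 1))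

  HStepFactor : Carrier → Carrier → Idx → Carrier
  HStepFactor r rinv (int k)  = powDiff r rinv (2 *ℕ suc k)
  HStepFactor r rinv (half k) = powDiff r rinv (2 *ℕ suc k ∸ 1)

  HStep-isPartialProduct : ∀ r rinv → IsPartialProduct (HStep r rinv) (HStepFactor r rinv)
  HStep-isPartialProduct r rinv = record
    { start-half = refl
    ; start-int  = refl
    ; step       = λ { (int k) → refl ; (half k) → refl }
    }

  H-isPartialProduct : ∀ r rinv → IsPartialProduct (H R r rinv) (HStep r rinv)
  H-isPartialProduct r rinv = record
    { start-half = refl
    ; start-int  = refl
    ; step       = λ { (int k)  → prodPow-suc (λ j → powDiff r rinv (2 *ℕ j)) k
                     ; (half k) → prodPow-suc (λ j → powDiff r rinv (2 *ℕ j ∸ 1)) k }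
    }

  HStepFactor-sq : ∀ r rinv i → HStepFactor (r * r) (rinv * rinv) i ≈ HStepFactor r rinv (int (halfOf⁻¹ i))
  HStepFactor-sq r rinv (int k)  = trans (powDiff-sq r rinv (2 *ℕ suc k))
    (reflexive (cong (λ n → powDiff r rinv (2 *ℕ n)) (*-suc 2 k)))
  HStepFactor-sq r rinv (half k) = trans (powDiff-sq r rinv (2 *ℕ suc k ∸ 1))
    (reflexive (cong (λ n → powDiff r rinv (2 *ℕ (n ∸ 1))) (*-suc 2 k)))

lemmaA3 : {c ℓ : Level} (R : CommutativeRing c ℓ) → let open CommutativeRing R in
    (r rinv : Carrier) → r * rinv ≈ 1# → (m : ℕ)
    → (Ht R r rinv (int m) ≈ ((Ht R (r * r) (rinv * rinv) (halfOf m) * Ht R (r * r) (rinv * rinv) (halfOf (suc m))) * Ht R (r * r) (rinv * rinv) (halfOf (suc m))) * Ht R (r * r) (rinv * rinv) (halfOf (suc (suc m))))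
      × (H R r rinv (int m) ≈ ((H R (r * r) (rinv * rinv) (halfOf m) * H R (r * r) (rinv * rinv) (halfOf (suc m))) * H R (r * r) (rinv * rinv) (halfOf (suc m))) * H R (r * r) (rinv * rinv) (halfOf (suc (suc m))))
lemmaA3 R r rinv _ m =
    interleave² R (Ht-isPartialProduct R r rinv) (Ht-isPartialProduct R r² rinv²) ≈-refl
      (interleave R (HtStep-isPartialProduct R r) (HtStep-isPartialProduct R r²) (HtStepFactor-sq R r)) m
  , interleave² R (H-isPartialProduct R r rinv) (H-isPartialProduct R r² rinv²) ≈-refl
      (interleave R (HStep-isPartialProduct R r rinv) (HStep-isPartialProduct R r² rinv²) (HStepFactor-sq R r rinv)) m
  where
  open CommutativeRing R using (Carrier; _*_) renaming (refl to ≈-refl)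
  r² rinv² : Carrier
  r²    = r * r
  rinv² = rinv * rinv
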